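{- Let $X$ be a set of size $n$ and let $h:X\to X$ be any function. Then there exists a bijection $\sigma:X\to\{1,\dots,n\}$ such that for every $v\in X$, if $\sigma(v)=j$ then $\sigma(h(v))\le j+1$. -}

-- Choose a root r, label it 0 and give h r the label 1; the elements other than r, with
-- every arrow into r turned into a loop, are then labelled recursively with h r as the new
-- root. An arrow into r ends at label 0, every other arrow is one of the smaller problem,
-- shifted up by one, and the root's arrow goes from 0 to 1.
module Submission where

open import Level using (Level)
open import Data.Nat using (ℕ; zero; suc; _≤_; z≤n; s≤s)
open import Data.Fin using (Fin; toℕ)
open import Data.Fin.Patterns using (0F)
open import Data.Fin.Properties using (_≟_; ¬Fin0)
open import Data.Fin.Permutation using (Permutation′; _⟨$⟩ʳ_; _∘ₚ_; lift₀; transpose)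
open import Data.Empty using (⊥-elim)
open import Data.Product using (Σ-syntax; _,_; _×_)
open import Function.Base using (_∘_)
open import Function.Bundles using (_⤖_; _↔_; Bijection; Inverse)
open import Function.Construct.Composition using (_⤖-∘_)
open import Function.Properties.Bijection using (⤖⇒↔)
open import Function.Properties.Inverse using (↔⇒⤖)
open import Relation.Binary.PropositionalEquality using (_≡_; refl; sym; subst)
open import Relation.Nullary.Decidable using (dec-true)

private
  variable
    a : Level
    X Y : Set a
    n : ℕ

StepBounded : (X → Fin n) → (X → X) → Set _
StepBounded label h = ∀ v → toℕ (label (h v)) ≤ suc (toℕ (label v))

conjugate : X ↔ Y → (X → X) → (Y → Y)
conjugate e h = Inverse.to e ∘ h ∘ Inverse.from e

stepBounded-conjugate : (e : X ↔ Y) {label : Y → Fin n} {h : X → X} →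
  StepBounded label (conjugate e h) → StepBounded (label ∘ Inverse.to e) h
stepBounded-conjugate e {label} {h} bounded v =
  subst (λ w → toℕ (label (Inverse.to e (h w))) ≤ suc (toℕ (label (Inverse.to e v))))
        (Inverse.strictlyInverseʳ e v)
        (bounded (Inverse.to e v))

stepBounded-Fin1 : (label : Fin 1 → Fin 1) (h : Fin 1 → Fin 1) → StepBounded label h
stepBounded-Fin1 label h v with label (h v)
... | 0F = z≤n

transpose-self : (i j : Fin n) → transpose i j ⟨$⟩ʳ i ≡ j
transpose-self i j rewrite dec-true (i ≟ i) refl = refl

predOr : Fin n → Fin (suc n) → Fin n
predOr d 0F          = d
predOr d (Fin.suc i) = i

removeZero : (Fin (suc (suc n)) → Fin (suc (suc n))) → Fin (suc n) → Fin (suc n)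
removeZero g y = predOr y (g (Fin.suc y))

stepBounded-lift₀ : (g : Fin (suc (suc n)) → Fin (suc (suc n))) (σ : Permutation′ (suc n)) →
  σ ⟨$⟩ʳ predOr 0F (g 0F) ≡ 0F → StepBounded (σ ⟨$⟩ʳ_) (removeZero g) →
  StepBounded (lift₀ σ ⟨$⟩ʳ_) g
stepBounded-lift₀ g σ rootLabel bounded 0F with g 0F
... | 0F = z≤n
... | Fin.suc i rewrite rootLabel = s≤s z≤n
stepBounded-lift₀ g σ rootLabel bounded (Fin.suc y) with g (Fin.suc y) | bounded y
... | 0F        | _    = z≤n
... | Fin.suc i | step = s≤s step

rootedLabelling : ∀ m (h : Fin (suc m) → Fin (suc m)) (r : Fin (suc m)) →
  Σ[ σ ∈ Permutation′ (suc m) ] (σ ⟨$⟩ʳ r ≡ 0F × StepBounded (σ ⟨$⟩ʳ_) h)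
rootedLabelling zero h r = transpose r 0F , transpose-self r 0F , stepBounded-Fin1 _ h
rootedLabelling (suc m) h r =
  let τ = transpose r 0F
      g = conjugate τ h
      σ , rootLabel , bounded = rootedLabelling m (removeZero g) (predOr 0F (g 0F))
  in τ ∘ₚ lift₀ σ ,
     subst (λ w → lift₀ σ ⟨$⟩ʳ w ≡ 0F) (sym (transpose-self r 0F)) refl ,
     stepBounded-conjugate τ {h = h} (stepBounded-lift₀ g σ rootLabel bounded)

mainTheorem3 : ∀ {a : Level} (X : Set a) (n : ℕ) → X ⤖ Fin n → (h : X → X) →
    Σ[ σ ∈ X ⤖ Fin n ] (∀ (v : X) → toℕ (Bijection.to σ (h v)) ≤ suc (toℕ (Bijection.to σ v)))
mainTheorem3 X zero    e h = e , λ v → ⊥-elim (¬Fin0 (Bijection.to e v))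
mainTheorem3 X (suc m) e h =
  let σ , _ , bounded = rootedLabelling m (conjugate (⤖⇒↔ e) h) 0F
  in ↔⇒⤖ σ ⤖-∘ e , stepBounded-conjugate (⤖⇒↔ e) {h = h} bounded
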